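{- Let $\mathsf{C}$ be a category with binary coproducts, $(T,\mu,\eta)$ a monad on $\mathsf{C}$, and $F:\mathsf{C}\to\mathsf{C}$ a functor lifting to $\overline{F}:\mathcal{K}l(T)\to\mathcal{K}l(T)$. Assume that for every object $X$ there is an initial $F(-)+X$-algebra $i_X:F(F^*X)+X\to F^*X$, and let $(F^*,m,e)$ be the associated free monad over $F$ (defined in the context). Let $\overline{F}^*$ be the endofunctor of $\mathcal{K}l(T)$ defined by $\overline{F}^*X=F^*X$ and, for $g:X\rightsquigarrow Y$, $\overline{F}^*g$ the unique $h:F^*X\rightsquigarrow F^*Y$ with $h\cdot i_X^\sharp=i_Y^\sharp\cdot(\overline{F}h+g)$. Then (i) $F^*$ lifts to $\overline{F}^*$, i.e. $\overline{F}^*(f^\sharp)=(F^*f)^\sharp$ for every morphism $f$ of $\mathsf{C}$; and (ii) $(\overline{F}^*,m^\sharp,e^\sharp)$ is a monad on $\mathcal{K}l(T)$ which is a free monad over $\overline{F}$.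
   Context: Kleisli category $\mathcal{K}l(T)$: objects of $\mathsf{C}$, morphisms $f:X\rightsquigarrow Y$ are morphisms $X\to TY$ of $\mathsf{C}$, composition $g\cdot f=\mu_Z\circ Tg\circ f$, identity $\eta_X$; for $f:X\to Y$ in $\mathsf{C}$, $f^\sharp=\eta_Y\circ f$, and for a natural transformation $\theta$ of $\mathsf{C}$, $\theta^\sharp$ has components $\theta_X^\sharp$. $F$ lifts to $\overline{F}$ means $\overline{F}X=FX$ and $\overline{F}(f^\sharp)=(Ff)^\sharp$ (equivalently $\overline{F}g=\lambda_Y\circ Fg$ for a distributive law $\lambda:FT\Rightarrow TF$). Coproducts in $\mathcal{K}l(T)$ are those of $\mathsf{C}$ with coprojections $\mathsf{inl}^\sharp,\mathsf{inr}^\sharp$. The free monad $(F^*,m,e)$: $F^*X$ is the carrier of $i_X$; for $f:X\to Y$, $F^*f$ is the unique morphism with $F^*f\circ i_X=i_Y\circ(F(F^*f)+f)$; $m_X:F^*F^*X\to F^*X$ is the unique morphism with $m_X\circ i_{F^*X}=[i_X\circ\mathsf{inl},id]\circ(F(m_X)+id)$; $e_X=i_X\circ\mathsf{inr}$. It is known that each $i_X^\sharp=\eta\circ i_X$ is an initial $\overline{F}(-)+X$-algebra in $\mathcal{K}l(T)$, so $\overline{F}^*$ is well defined. -}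

module Defs where

open import Level using (Level; _⊔_; suc)
open import Relation.Binary using (Rel; IsEquivalence)

record RawCat (o ℓ e : Level) : Set (suc (o ⊔ ℓ ⊔ e)) where
  infix 4 _≈_ _⇒_
  infixr 9 _∘_
  field
    Obj : Set o
    _⇒_ : Obj → Obj → Set ℓ
    _≈_ : ∀ {A B} → Rel (A ⇒ B) e
    id  : ∀ {A} → A ⇒ A
    _∘_ : ∀ {A B C} → B ⇒ C → A ⇒ B → A ⇒ C

record IsCategory {o ℓ e} (R : RawCat o ℓ e) : Set (o ⊔ ℓ ⊔ e) where
  open RawCat R
  field
    equiv     : ∀ {A B} → IsEquivalence (_≈_ {A} {B})
    ∘-resp-≈  : ∀ {A B C} {f h : B ⇒ C} {g k : A ⇒ B} → f ≈ h → g ≈ k → f ∘ g ≈ h ∘ k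
    assoc     : ∀ {A B C D} {f : A ⇒ B} {g : B ⇒ C} {h : C ⇒ D} → (h ∘ g) ∘ f ≈ h ∘ (g ∘ f)
    identityˡ : ∀ {A B} {f : A ⇒ B} → id ∘ f ≈ f
    identityʳ : ∀ {A B} {f : A ⇒ B} → f ∘ id ≈ f

record Category (o ℓ e : Level) : Set (suc (o ⊔ ℓ ⊔ e)) where
  field
    raw        : RawCat o ℓ e
    isCategory : IsCategory raw
  open RawCat raw public
  open IsCategory isCategory public

record IsEndofunctor {o ℓ e} (R : RawCat o ℓ e)
         (F₀ : RawCat.Obj R → RawCat.Obj R)
         (F₁ : ∀ {A B} → RawCat._⇒_ R A B → RawCat._⇒_ R (F₀ A) (F₀ B))
         : Set (o ⊔ ℓ ⊔ e) where
  open RawCat R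
  field
    F-resp-≈     : ∀ {A B} {f g : A ⇒ B} → f ≈ g → F₁ f ≈ F₁ g
    identity     : ∀ {A} → F₁ (id {A}) ≈ id
    homomorphism : ∀ {A B C} {f : A ⇒ B} {g : B ⇒ C} → F₁ (g ∘ f) ≈ F₁ g ∘ F₁ f

record Endofunctor {o ℓ e} (C : Category o ℓ e) : Set (o ⊔ ℓ ⊔ e) where
  open Category C
  field
    F₀ : Obj → Obj
    F₁ : ∀ {A B} → A ⇒ B → F₀ A ⇒ F₀ B
    isEndofunctor : IsEndofunctor raw F₀ F₁
  open IsEndofunctor isEndofunctor public

record IsMonadOn {o ℓ e} (R : RawCat o ℓ e)
         (M₀ : RawCat.Obj R → RawCat.Obj R)
         (M₁ : ∀ {A B} → RawCat._⇒_ R A B → RawCat._⇒_ R (M₀ A) (M₀ B))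
         (η : ∀ X → RawCat._⇒_ R X (M₀ X))
         (μ : ∀ X → RawCat._⇒_ R (M₀ (M₀ X)) (M₀ X))
         : Set (o ⊔ ℓ ⊔ e) where
  open RawCat R
  field
    isEndofunctor : IsEndofunctor R M₀ M₁
    η-natural : ∀ {X Y} (f : X ⇒ Y) → M₁ f ∘ η X ≈ η Y ∘ f
    μ-natural : ∀ {X Y} (f : X ⇒ Y) → M₁ f ∘ μ X ≈ μ Y ∘ M₁ (M₁ f)
    assoc     : ∀ {X} → μ X ∘ M₁ (μ X) ≈ μ X ∘ μ (M₀ X)
    identityˡ : ∀ {X} → μ X ∘ M₁ (η X) ≈ id
    identityʳ : ∀ {X} → μ X ∘ η (M₀ X) ≈ id

record Monad {o ℓ e} (C : Category o ℓ e) : Set (o ⊔ ℓ ⊔ e) where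
  open Category C
  field
    T₀ : Obj → Obj
    T₁ : ∀ {A B} → A ⇒ B → T₀ A ⇒ T₀ B
    η  : ∀ X → X ⇒ T₀ X
    μ  : ∀ X → T₀ (T₀ X) ⇒ T₀ X
    isMonad : IsMonadOn raw T₀ T₁ η μ

record BinaryCoproducts {o ℓ e} (C : Category o ℓ e) : Set (o ⊔ ℓ ⊔ e) where
  open Category C
  infixr 6 _+_
  field
    _+_ : Obj → Obj → Obj
    inl : ∀ {A B} → A ⇒ A + B
    inr : ∀ {A B} → B ⇒ A + B
    [_,_] : ∀ {A B Z} → A ⇒ Z → B ⇒ Z → A + B ⇒ Z
    inl-commute : ∀ {A B Z} {f : A ⇒ Z} {g : B ⇒ Z} → [ f , g ] ∘ inl ≈ f
    inr-commute : ∀ {A B Z} {f : A ⇒ Z} {g : B ⇒ Z} → [ f , g ] ∘ inr ≈ g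
    unique : ∀ {A B Z} {f : A ⇒ Z} {g : B ⇒ Z} {h : A + B ⇒ Z} →
             h ∘ inl ≈ f → h ∘ inr ≈ g → h ≈ [ f , g ]

  infixr 7 _+₁_
  _+₁_ : ∀ {A B A' B'} → A ⇒ A' → B ⇒ B' → A + B ⇒ A' + B'
  f +₁ g = [ inl ∘ f , inr ∘ g ]

record IsInitialAlgebra {o ℓ e} (R : RawCat o ℓ e)
         (G₀ : RawCat.Obj R → RawCat.Obj R)
         (G₁ : ∀ {A B} → RawCat._⇒_ R A B → RawCat._⇒_ R (G₀ A) (G₀ B))
         {I : RawCat.Obj R} (i : RawCat._⇒_ R (G₀ I) I)
         : Set (o ⊔ ℓ ⊔ e) where
  open RawCat R
  field
    fold        : ∀ {A} → G₀ A ⇒ A → I ⇒ A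
    fold-eq     : ∀ {A} (a : G₀ A ⇒ A) → fold a ∘ i ≈ a ∘ G₁ (fold a)
    fold-unique : ∀ {A} (a : G₀ A ⇒ A) (h : I ⇒ A) → h ∘ i ≈ a ∘ G₁ h → h ≈ fold a

module Kleisli {o ℓ e} (C : Category o ℓ e) (T : Monad C) where
  open Category C
  open Monad T

  Kl : RawCat o ℓ e
  Kl = record
    { Obj = Obj
    ; _⇒_ = λ X Y → X ⇒ T₀ Y
    ; _≈_ = _≈_
    ; id  = λ {X} → η X
    ; _∘_ = λ {X} {Y} {Z} g f → μ Z ∘ (T₁ g ∘ f)
    }

  infixr 9 _·_
  _·_ : ∀ {X Y Z} → Y ⇒ T₀ Z → X ⇒ T₀ Y → X ⇒ T₀ Z
  _·_ = RawCat._∘_ Kl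

  kid : ∀ {X} → X ⇒ T₀ X
  kid {X} = η X

  _♯ : ∀ {X Y} → X ⇒ Y → X ⇒ T₀ Y
  _♯ {Y = Y} f = η Y ∘ f

  -- Coproducts of Kl(T): those of C, with coprojections inl♯, inr♯
  -- (copairing in Kl(T) is copairing in C).
  module KlCoproducts (cop : BinaryCoproducts C) where
    open BinaryCoproducts cop

    infixr 7 _+ᴷ_
    _+ᴷ_ : ∀ {A B A' B'} → A ⇒ T₀ A' → B ⇒ T₀ B' → A + B ⇒ T₀ (A' + B')
    f +ᴷ g = [ (inl ♯) · f , (inr ♯) · g ]

record Lifting {o ℓ e} (C : Category o ℓ e) (T : Monad C) (F : Endofunctor C)
         : Set (o ⊔ ℓ ⊔ e) where
  open Category C
  open Monad T
  open Endofunctor F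
  open Kleisli C T
  field
    F̄₁ : ∀ {X Y} → X ⇒ T₀ Y → F₀ X ⇒ T₀ (F₀ Y)
    isEndofunctor : IsEndofunctor Kl F₀ F̄₁
    lifts : ∀ {X Y} (f : X ⇒ Y) → F̄₁ (f ♯) ≈ (F₁ f) ♯

module FreeMonadSetting
  {o ℓ e} (C : Category o ℓ e) (cop : BinaryCoproducts C)
  (T : Monad C) (F : Endofunctor C) (L : Lifting C T F) where
  open Category C
  open BinaryCoproducts cop
  open Monad T
  open Endofunctor F
  open Lifting L
  open Kleisli C T
  open KlCoproducts cop

  InitialInC : (F* : Obj → Obj) → (∀ X → F₀ (F* X) + X ⇒ F* X) → Set (o ⊔ ℓ ⊔ e)
  InitialInC F* i = ∀ X → IsInitialAlgebra raw (λ A → F₀ A + X) (λ h → F₁ h +₁ id) (i X)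

  InitialInKl : (F* : Obj → Obj) → (∀ X → F₀ (F* X) + X ⇒ F* X) → Set (o ⊔ ℓ ⊔ e)
  InitialInKl F* i = ∀ X → IsInitialAlgebra Kl (λ A → F₀ A + X) (λ h → F̄₁ h +ᴷ kid) ((i X) ♯)

  module Free (F* : Obj → Obj) (i : ∀ X → F₀ (F* X) + X ⇒ F* X)
              (init : InitialInC F* i) (initᴷ : InitialInKl F* i) where

    F*₁ : ∀ {X Y} → X ⇒ Y → F* X ⇒ F* Y
    F*₁ {X} {Y} f = IsInitialAlgebra.fold (init X) (i Y ∘ (id +₁ f))

    m : ∀ X → F* (F* X) ⇒ F* X
    m X = IsInitialAlgebra.fold (init (F* X)) [ i X ∘ inl , id ]

    e′ : ∀ X → X ⇒ F* X
    e′ X = i X ∘ inr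

    F̄*₁ : ∀ {X Y} → X ⇒ T₀ Y → F* X ⇒ T₀ (F* Y)
    F̄*₁ {X} {Y} g = IsInitialAlgebra.fold (initᴷ X) ((i Y ♯) · (kid +ᴷ g))

-- Running the free-monad construction in Kl(T) on the initial F̄(-)+X-algebras
-- i_X♯ yields exactly F̄*, and it yields m♯ and e♯ because (-)♯ : C → Kl(T)
-- carries folds to folds: it preserves coproducts and, by the lifting, turns
-- F into F̄.  In any category with coproducts, the monad laws of the free-monad
-- construction follow from one uniqueness principle: a map h : G*Z → G*Y with
-- h ∘ ι = [ ι ∘ inl ∘ G h , k ] (the substitution of k) is determined by k,
-- and a substitution followed by a substitution is again one.
module Submission where

open import Data.Product using (_×_; _,_)
open import Level using (_⊔_)
open import Relation.Binary using (IsEquivalence)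
open import Defs

module HomReasoning {o ℓ e} (C : Category o ℓ e) where
  open Category C

  module _ {A B : Obj} where
    open IsEquivalence (equiv {A} {B}) public
      using () renaming (refl to ≈-refl; sym to ≈-sym; trans to ≈-trans)

  infix  1 begin_
  infixr 2 _≈⟨_⟩_ _≈⟨_⟨_
  infix  3 _∎
  infixr 4 _⟩∘⟨_ refl⟩∘⟨_
  infixl 5 _⟩∘⟨refl

  begin_ : ∀ {A B} {f g : A ⇒ B} → f ≈ g → f ≈ g
  begin p = p

  _≈⟨_⟩_ : ∀ {A B} (f : A ⇒ B) {g h} → f ≈ g → g ≈ h → f ≈ h
  _ ≈⟨ p ⟩ q = ≈-trans p q

  _≈⟨_⟨_ : ∀ {A B} (f : A ⇒ B) {g h} → g ≈ f → g ≈ h → f ≈ h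
  _ ≈⟨ p ⟨ q = ≈-trans (≈-sym p) q

  _∎ : ∀ {A B} (f : A ⇒ B) → f ≈ f
  _ ∎ = ≈-refl

  _⟩∘⟨_ : ∀ {A B D} {f h : B ⇒ D} {g k : A ⇒ B} → f ≈ h → g ≈ k → f ∘ g ≈ h ∘ k
  _⟩∘⟨_ = ∘-resp-≈

  refl⟩∘⟨_ : ∀ {A B D} {f : B ⇒ D} {g k : A ⇒ B} → g ≈ k → f ∘ g ≈ f ∘ k
  refl⟩∘⟨ p = ≈-refl ⟩∘⟨ p

  _⟩∘⟨refl : ∀ {A B D} {f h : B ⇒ D} {g : A ⇒ B} → f ≈ h → f ∘ g ≈ h ∘ g
  p ⟩∘⟨refl = p ⟩∘⟨ ≈-refl

module CoproductProperties {o ℓ e} {C : Category o ℓ e} (cop : BinaryCoproducts C) where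
  open Category C
  open BinaryCoproducts cop
  open HomReasoning C

  []-cong : ∀ {A B Z} {f f' : A ⇒ Z} {g g' : B ⇒ Z} → f ≈ f' → g ≈ g' → [ f , g ] ≈ [ f' , g' ]
  []-cong p q = unique (≈-trans inl-commute p) (≈-trans inr-commute q)

  []-η : ∀ {A B Z} {h : A + B ⇒ Z} → [ h ∘ inl , h ∘ inr ] ≈ h
  []-η = ≈-sym (unique ≈-refl ≈-refl)

  ∘-distribˡ-[] : ∀ {A B Z W} {h : Z ⇒ W} {f : A ⇒ Z} {g : B ⇒ Z} →
                  h ∘ [ f , g ] ≈ [ h ∘ f , h ∘ g ]
  ∘-distribˡ-[] = unique (≈-trans assoc (refl⟩∘⟨ inl-commute))
                         (≈-trans assoc (refl⟩∘⟨ inr-commute))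

  []∘+₁ : ∀ {A B A' B' Z} {f : A' ⇒ Z} {g : B' ⇒ Z} {c : A ⇒ A'} {d : B ⇒ B'} →
          [ f , g ] ∘ (c +₁ d) ≈ [ f ∘ c , g ∘ d ]
  []∘+₁ = ≈-trans ∘-distribˡ-[]
            ([]-cong (≈-trans (≈-sym assoc) (inl-commute ⟩∘⟨refl))
                     (≈-trans (≈-sym assoc) (inr-commute ⟩∘⟨refl)))

  +₁-cong : ∀ {A B A' B'} {c c' : A ⇒ A'} {d d' : B ⇒ B'} → c ≈ c' → d ≈ d' → c +₁ d ≈ c' +₁ d'
  +₁-cong p q = []-cong (refl⟩∘⟨ p) (refl⟩∘⟨ q)

module _ {o ℓ e} (C : Category o ℓ e) where
  open Category C
  open HomReasoning C

  fold-cong : ∀ {G₀ : Obj → Obj} {G₁ : ∀ {A B} → A ⇒ B → G₀ A ⇒ G₀ B} {I} {i : G₀ I ⇒ I}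
              (alg : IsInitialAlgebra raw G₀ G₁ i) {A} {a a' : G₀ A ⇒ A} →
              a ≈ a' → IsInitialAlgebra.fold alg a ≈ IsInitialAlgebra.fold alg a'
  fold-cong alg {a = a} {a'} a≈a' =
    fold-unique a' (fold a) (≈-trans (fold-eq a) (a≈a' ⟩∘⟨refl))
    where open IsInitialAlgebra alg

  IsMonadOn-resp : ∀ {M₀ : Obj → Obj} {M₁ : ∀ {A B} → A ⇒ B → M₀ A ⇒ M₀ B}
                   {η η' : ∀ X → X ⇒ M₀ X} {μ μ' : ∀ X → M₀ (M₀ X) ⇒ M₀ X} →
                   (∀ X → η' X ≈ η X) → (∀ X → μ' X ≈ μ X) →
                   IsMonadOn raw M₀ M₁ η μ → IsMonadOn raw M₀ M₁ η' μ'
  IsMonadOn-resp {M₀} {M₁} {η} {η'} {μ} {μ'} η'≈η μ'≈μ monad = record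
    { isEndofunctor = isEndofunctor
    ; η-natural = λ f → begin
        M₁ f ∘ η' _ ≈⟨ refl⟩∘⟨ η'≈η _ ⟩
        M₁ f ∘ η _  ≈⟨ η-natural f ⟩
        η _ ∘ f     ≈⟨ η'≈η _ ⟩∘⟨refl ⟨
        η' _ ∘ f    ∎
    ; μ-natural = λ f → begin
        M₁ f ∘ μ' _       ≈⟨ refl⟩∘⟨ μ'≈μ _ ⟩
        M₁ f ∘ μ _        ≈⟨ μ-natural f ⟩
        μ _ ∘ M₁ (M₁ f)   ≈⟨ μ'≈μ _ ⟩∘⟨refl ⟨
        μ' _ ∘ M₁ (M₁ f)  ∎
    ; assoc = λ {X} → begin
        μ' X ∘ M₁ (μ' X)    ≈⟨ μ'≈μ X ⟩∘⟨ F-resp-≈ (μ'≈μ X) ⟩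
        μ X ∘ M₁ (μ X)      ≈⟨ M.assoc ⟩
        μ X ∘ μ (M₀ X)      ≈⟨ μ'≈μ X ⟩∘⟨ μ'≈μ (M₀ X) ⟨
        μ' X ∘ μ' (M₀ X)    ∎
    ; identityˡ = ≈-trans (μ'≈μ _ ⟩∘⟨ F-resp-≈ (η'≈η _)) M.identityˡ
    ; identityʳ = ≈-trans (μ'≈μ _ ⟩∘⟨ η'≈η _) M.identityʳ
    }
    where module M = IsMonadOn monad
          open M using (isEndofunctor; η-natural; μ-natural)
          open IsEndofunctor isEndofunctor using (F-resp-≈)

module FreeMonadConstruction {o ℓ e} {D : Category o ℓ e}
    (cop : BinaryCoproducts D) (G : Endofunctor D) where
  open Category D
  open BinaryCoproducts cop
  open Endofunctor G renaming (F₀ to G₀; F₁ to G₁)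
  open HomReasoning D
  open CoproductProperties cop

  InitialAlgebras : (G* : Obj → Obj) → (∀ X → G₀ (G* X) + X ⇒ G* X) → Set (o ⊔ ℓ ⊔ e)
  InitialAlgebras G* ι = ∀ X → IsInitialAlgebra raw (λ A → G₀ A + X) (λ h → G₁ h +₁ id) (ι X)

  G₁-fuse : ∀ {A B Z W} {f : G₀ Z ⇒ W} {g : B ⇒ Z} {h : A ⇒ B} → (f ∘ G₁ g) ∘ G₁ h ≈ f ∘ G₁ (g ∘ h)
  G₁-fuse = ≈-trans assoc (refl⟩∘⟨ ≈-sym homomorphism)

  module FromInitialAlgebras (G* : Obj → Obj) (ι : ∀ X → G₀ (G* X) + X ⇒ G* X)
                             (init : InitialAlgebras G* ι) where
    module I X = IsInitialAlgebra (init X)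

    G*₁ : ∀ {X Y} → X ⇒ Y → G* X ⇒ G* Y
    G*₁ {X} {Y} g = I.fold X (ι Y ∘ (id +₁ g))

    unit : ∀ X → X ⇒ G* X
    unit X = ι X ∘ inr

    join : ∀ X → G* (G* X) ⇒ G* X
    join X = I.fold (G* X) [ ι X ∘ inl , id ]

    -- h is the substitution of k: it keeps operation nodes and replaces variables by k.
    IsExtension : ∀ {Z Y} → Z ⇒ G* Y → G* Z ⇒ G* Y → Set e
    IsExtension {Z} {Y} k h = h ∘ ι Z ≈ [ (ι Y ∘ inl) ∘ G₁ h , k ]

    extension-unique : ∀ {Z Y} {k k' : Z ⇒ G* Y} {h h' : G* Z ⇒ G* Y} →
                       k ≈ k' → IsExtension k h → IsExtension k' h' → h ≈ h'
    extension-unique {Z} {Y} {k} k≈k' ext ext' =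
      ≈-trans (I.fold-unique Z _ _ (algebra-map ext))
              (≈-sym (I.fold-unique Z _ _ (algebra-map (≈-trans ext' ([]-cong ≈-refl (≈-sym k≈k'))))))
      where
        algebra-map : ∀ {h} → IsExtension k h → h ∘ ι Z ≈ [ ι Y ∘ inl , k ] ∘ (G₁ h +₁ id)
        algebra-map ext = ≈-trans ext (≈-sym (≈-trans []∘+₁ ([]-cong ≈-refl identityʳ)))

    extension-inl : ∀ {Z Y} {k : Z ⇒ G* Y} {h} → IsExtension k h →
                    h ∘ (ι Z ∘ inl) ≈ (ι Y ∘ inl) ∘ G₁ h
    extension-inl ext = ≈-trans (≈-sym assoc) (≈-trans (ext ⟩∘⟨refl) inl-commute)

    extension-unit : ∀ {Z Y} {k : Z ⇒ G* Y} {h} → IsExtension k h → h ∘ unit Z ≈ k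
    extension-unit ext = ≈-trans (≈-sym assoc) (≈-trans (ext ⟩∘⟨refl) inr-commute)

    extension-unit-∘ : ∀ {W Z Y} {k : Z ⇒ G* Y} {h} {f : W ⇒ Z} → IsExtension k h →
                       h ∘ (unit Z ∘ f) ≈ k ∘ f
    extension-unit-∘ ext = ≈-trans (≈-sym assoc) (extension-unit ext ⟩∘⟨refl)

    extension-∘ : ∀ {Z Y V} {k : Z ⇒ G* Y} {h} {k' : Y ⇒ G* V} {j} →
                  IsExtension k h → IsExtension k' j → IsExtension (j ∘ k) (j ∘ h)
    extension-∘ {Z} {Y} {V} {k} {h} {k'} {j} ext ext' = begin
      (j ∘ h) ∘ ι Z                                 ≈⟨ assoc ⟩
      j ∘ (h ∘ ι Z)                                 ≈⟨ refl⟩∘⟨ ext ⟩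
      j ∘ [ (ι Y ∘ inl) ∘ G₁ h , k ]                ≈⟨ ∘-distribˡ-[] ⟩
      [ j ∘ ((ι Y ∘ inl) ∘ G₁ h) , j ∘ k ]          ≈⟨ []-cong inl-case ≈-refl ⟩
      [ (ι V ∘ inl) ∘ G₁ (j ∘ h) , j ∘ k ]          ∎
      where
        inl-case : j ∘ ((ι Y ∘ inl) ∘ G₁ h) ≈ (ι V ∘ inl) ∘ G₁ (j ∘ h)
        inl-case = ≈-trans (≈-sym assoc) (≈-trans (extension-inl ext' ⟩∘⟨refl) G₁-fuse)

    id-extension : ∀ {X} → IsExtension (unit X) id
    id-extension {X} = begin
      id ∘ ι X                              ≈⟨ identityˡ ⟩
      ι X                                   ≈⟨ []-η ⟨
      [ ι X ∘ inl , ι X ∘ inr ]             ≈⟨ []-cong (≈-trans (refl⟩∘⟨ identity) identityʳ) ≈-refl ⟨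
      [ (ι X ∘ inl) ∘ G₁ id , unit X ]      ∎

    G*₁-extension : ∀ {X Y} (g : X ⇒ Y) → IsExtension (unit Y ∘ g) (G*₁ g)
    G*₁-extension {X} {Y} g = begin
      G*₁ g ∘ ι X                                            ≈⟨ I.fold-eq X _ ⟩
      (ι Y ∘ (id +₁ g)) ∘ (G₁ (G*₁ g) +₁ id)                 ≈⟨ assoc ⟩
      ι Y ∘ ((id +₁ g) ∘ (G₁ (G*₁ g) +₁ id))                 ≈⟨ refl⟩∘⟨ []∘+₁ ⟩
      ι Y ∘ [ (inl ∘ id) ∘ G₁ (G*₁ g) , (inr ∘ g) ∘ id ]     ≈⟨ ∘-distribˡ-[] ⟩
      [ ι Y ∘ ((inl ∘ id) ∘ G₁ (G*₁ g)) , ι Y ∘ ((inr ∘ g) ∘ id) ]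
        ≈⟨ []-cong (≈-trans (refl⟩∘⟨ (identityʳ ⟩∘⟨refl)) (≈-sym assoc))
                   (≈-trans (refl⟩∘⟨ identityʳ) (≈-sym assoc)) ⟩
      [ (ι Y ∘ inl) ∘ G₁ (G*₁ g) , unit Y ∘ g ]              ∎

    join-extension : ∀ {X} → IsExtension id (join X)
    join-extension {X} = ≈-trans (I.fold-eq (G* X) _) (≈-trans []∘+₁ ([]-cong ≈-refl identityˡ))

    isMonad : IsMonadOn raw G* G*₁ unit join
    isMonad = record
      { isEndofunctor = record
        { F-resp-≈ = λ f≈g → extension-unique (refl⟩∘⟨ f≈g) (G*₁-extension _) (G*₁-extension _)
        ; identity = extension-unique identityʳ (G*₁-extension id) id-extension
        ; homomorphism = λ {_} {_} {_} {f} {g} → extension-unique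
            (≈-trans (≈-sym assoc) (≈-sym (extension-unit-∘ (G*₁-extension g))))
            (G*₁-extension (g ∘ f)) (extension-∘ (G*₁-extension f) (G*₁-extension g))
        }
      ; η-natural = λ f → extension-unit (G*₁-extension f)
      ; μ-natural = λ f → extension-unique
          (≈-trans identityʳ (≈-trans (≈-sym identityˡ) (≈-sym (extension-unit-∘ join-extension))))
          (extension-∘ join-extension (G*₁-extension f))
          (extension-∘ (G*₁-extension (G*₁ f)) join-extension)
      ; assoc = extension-unique
          (≈-trans (extension-unit-∘ join-extension) (≈-trans identityˡ (≈-sym identityʳ)))
          (extension-∘ (G*₁-extension _) join-extension)
          (extension-∘ join-extension join-extension)
      ; identityˡ = extension-unique
          (≈-trans (extension-unit-∘ join-extension) identityˡ)
          (extension-∘ (G*₁-extension _) join-extension) id-extension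
      ; identityʳ = extension-unit join-extension
      }

module KleisliCategory {o ℓ e} (C : Category o ℓ e) (T : Monad C) where
  open Category C
  open HomReasoning C
  open Monad T
  open Kleisli C T
  private
    module M = IsMonadOn isMonad
    module MF = IsEndofunctor M.isEndofunctor

  ·-cong : ∀ {A B Z} {g g' : B ⇒ T₀ Z} {f f' : A ⇒ T₀ B} → g ≈ g' → f ≈ f' → g · f ≈ g' · f'
  ·-cong p q = refl⟩∘⟨ MF.F-resp-≈ p ⟩∘⟨ q

  ·-identityˡ : ∀ {A B} {f : A ⇒ T₀ B} → kid · f ≈ f
  ·-identityˡ = ≈-trans (≈-sym assoc) (≈-trans (M.identityˡ ⟩∘⟨refl) identityˡ)

  ·-identityʳ : ∀ {A B} {f : A ⇒ T₀ B} → f · kid ≈ f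
  ·-identityʳ {f = f} = begin
    μ _ ∘ (T₁ f ∘ η _)       ≈⟨ refl⟩∘⟨ M.η-natural f ⟩
    μ _ ∘ (η _ ∘ f)          ≈⟨ assoc ⟨
    (μ _ ∘ η _) ∘ f          ≈⟨ M.identityʳ ⟩∘⟨refl ⟩
    id ∘ f                   ≈⟨ identityˡ ⟩
    f                        ∎

  ·-assoc : ∀ {A B Z W} {f : A ⇒ T₀ B} {g : B ⇒ T₀ Z} {h : Z ⇒ T₀ W} → (h · g) · f ≈ h · (g · f)
  ·-assoc {f = f} {g} {h} = begin
    μ _ ∘ (T₁ (μ _ ∘ (T₁ h ∘ g)) ∘ f)              ≈⟨ refl⟩∘⟨ ≈-trans MF.homomorphism (refl⟩∘⟨ MF.homomorphism) ⟩∘⟨refl ⟩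
    μ _ ∘ ((T₁ (μ _) ∘ (T₁ (T₁ h) ∘ T₁ g)) ∘ f)    ≈⟨ ≈-trans (refl⟩∘⟨ assoc) (≈-sym assoc) ⟩
    (μ _ ∘ T₁ (μ _)) ∘ ((T₁ (T₁ h) ∘ T₁ g) ∘ f)    ≈⟨ M.assoc ⟩∘⟨refl ⟩
    (μ _ ∘ μ _) ∘ ((T₁ (T₁ h) ∘ T₁ g) ∘ f)         ≈⟨ ≈-trans assoc (refl⟩∘⟨ ≈-trans (refl⟩∘⟨ assoc) (≈-sym assoc)) ⟩
    μ _ ∘ ((μ _ ∘ T₁ (T₁ h)) ∘ (T₁ g ∘ f))         ≈⟨ refl⟩∘⟨ M.μ-natural h ⟩∘⟨refl ⟨
    μ _ ∘ ((T₁ h ∘ μ _) ∘ (T₁ g ∘ f))              ≈⟨ refl⟩∘⟨ assoc ⟩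
    μ _ ∘ (T₁ h ∘ (μ _ ∘ (T₁ g ∘ f)))              ∎

  KlCategory : Category o ℓ e
  KlCategory = record
    { raw = Kl
    ; isCategory = record
      { equiv = equiv
      ; ∘-resp-≈ = ·-cong
      ; assoc = ·-assoc
      ; identityˡ = ·-identityˡ
      ; identityʳ = ·-identityʳ
      }
    }

  ·-♯ : ∀ {A B Z} {g : B ⇒ T₀ Z} {f : A ⇒ B} → g · f ♯ ≈ g ∘ f
  ·-♯ {g = g} {f} = begin
    μ _ ∘ (T₁ g ∘ (η _ ∘ f))     ≈⟨ refl⟩∘⟨ ≈-trans (≈-sym assoc) (M.η-natural g ⟩∘⟨refl) ⟩
    μ _ ∘ ((η _ ∘ g) ∘ f)        ≈⟨ ≈-trans (refl⟩∘⟨ assoc) (≈-sym assoc) ⟩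
    (μ _ ∘ η _) ∘ (g ∘ f)        ≈⟨ M.identityʳ ⟩∘⟨refl ⟩
    id ∘ (g ∘ f)                 ≈⟨ identityˡ ⟩
    g ∘ f                        ∎

  ♯-∘ : ∀ {A B Z} {g : B ⇒ Z} {f : A ⇒ B} → (g ∘ f) ♯ ≈ g ♯ · f ♯
  ♯-∘ = ≈-sym (≈-trans ·-♯ assoc)

  ♯-cong : ∀ {A B} {f g : A ⇒ B} → f ≈ g → f ♯ ≈ g ♯
  ♯-cong p = refl⟩∘⟨ p

  module _ (cop : BinaryCoproducts C) where
    open BinaryCoproducts cop
    open KlCoproducts cop
    open CoproductProperties cop

    -- Copairing in Kl(T) is copairing in C, so the induced action on morphisms
    -- is _+ᴷ_ on the nose and the free-monad construction over F̄ gives F̄*₁ itself.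
    klCoproducts : BinaryCoproducts KlCategory
    klCoproducts = record
      { _+_ = _+_
      ; inl = inl ♯
      ; inr = inr ♯
      ; [_,_] = [_,_]
      ; inl-commute = ≈-trans ·-♯ inl-commute
      ; inr-commute = ≈-trans ·-♯ inr-commute
      ; unique = λ p q → unique (≈-trans (≈-sym ·-♯) p) (≈-trans (≈-sym ·-♯) q)
      }

    ♯-[] : ∀ {A B Z} {f : A ⇒ Z} {g : B ⇒ Z} → [ f , g ] ♯ ≈ [ f ♯ , g ♯ ]
    ♯-[] = ∘-distribˡ-[]

    ♯-+₁ : ∀ {A B A' B'} {f : A ⇒ A'} {g : B ⇒ B'} → (f +₁ g) ♯ ≈ f ♯ +ᴷ g ♯
    ♯-+₁ = ≈-trans ♯-[] ([]-cong ♯-∘ ♯-∘)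

  liftedFunctor : ∀ {F : Endofunctor C} → Lifting C T F → Endofunctor KlCategory
  liftedFunctor {F} L = record
    { F₀ = Endofunctor.F₀ F
    ; F₁ = Lifting.F̄₁ L
    ; isEndofunctor = Lifting.isEndofunctor L
    }

module KleisliFolds {o ℓ e} (C : Category o ℓ e) (cop : BinaryCoproducts C)
    (T : Monad C) (F : Endofunctor C) (L : Lifting C T F) where
  open Category C using (_⇒_; _∘_; id; _≈_; raw; identityʳ)
  open BinaryCoproducts cop using (_+_; _+₁_)
  open Endofunctor F using (F₀; F₁)
  open Lifting L using (F̄₁; lifts)
  open Kleisli C T
  open KlCoproducts cop
  open KleisliCategory C T
  open HomReasoning KlCategory
  open CoproductProperties (klCoproducts cop) using (+₁-cong)

  ♯-algebra-map : ∀ {X I A} {i : F₀ I + X ⇒ I} {a : F₀ A + X ⇒ A} {h : I ⇒ A} →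
                  h ∘ i ≈ a ∘ (F₁ h +₁ id) → h ♯ · i ♯ ≈ a ♯ · (F̄₁ (h ♯) +ᴷ kid)
  ♯-algebra-map {i = i} {a} {h} hom = begin
    h ♯ · i ♯                       ≈⟨ ♯-∘ ⟨
    (h ∘ i) ♯                       ≈⟨ ♯-cong hom ⟩
    (a ∘ (F₁ h +₁ id)) ♯            ≈⟨ ♯-∘ ⟩
    a ♯ · (F₁ h +₁ id) ♯            ≈⟨ refl⟩∘⟨ ♯-+₁ cop ⟩
    a ♯ · ((F₁ h) ♯ +ᴷ id ♯)        ≈⟨ refl⟩∘⟨ +₁-cong (≈-sym (lifts h)) identityʳ ⟩
    a ♯ · (F̄₁ (h ♯) +ᴷ kid)         ∎

  fold-♯ : ∀ {X I} {i : F₀ I + X ⇒ I}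
           (initC : IsInitialAlgebra raw (λ A → F₀ A + X) (λ h → F₁ h +₁ id) i)
           (initK : IsInitialAlgebra Kl (λ A → F₀ A + X) (λ h → F̄₁ h +ᴷ kid) (i ♯))
           {A} (a : F₀ A + X ⇒ A) →
           IsInitialAlgebra.fold initC a ♯ ≈ IsInitialAlgebra.fold initK (a ♯)
  fold-♯ initC initK a =
    IsInitialAlgebra.fold-unique initK (a ♯) _ (♯-algebra-map (IsInitialAlgebra.fold-eq initC a))

module FreeMonadInKleisli {o ℓ e} (C : Category o ℓ e) (cop : BinaryCoproducts C)
    (T : Monad C) (F : Endofunctor C) (L : Lifting C T F)
    (F* : Category.Obj C → Category.Obj C)
    (i : ∀ X → Category._⇒_ C (BinaryCoproducts._+_ cop (Endofunctor.F₀ F (F* X)) X) (F* X))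
    (init : FreeMonadSetting.InitialInC C cop T F L F* i)
    (initᴷ : FreeMonadSetting.InitialInKl C cop T F L F* i) where
  open Category C using (_⇒_; _∘_; id; _≈_; identityʳ)
  open BinaryCoproducts cop using (inl; [_,_]; _+₁_)
  open Lifting L using (F̄₁)
  open Kleisli C T
  open KlCoproducts cop
  open FreeMonadSetting.Free C cop T F L F* i init initᴷ
  open KleisliCategory C T
  open HomReasoning KlCategory
  open CoproductProperties (klCoproducts cop) using ([]-cong; +₁-cong)
  open KleisliFolds C cop T F L
  open FreeMonadConstruction.FromInitialAlgebras (klCoproducts cop) (liftedFunctor L)
         F* (λ X → i X ♯) initᴷ

  F̄*-lifts : ∀ {X Y} (f : X ⇒ Y) → F̄*₁ (f ♯) ≈ (F*₁ f) ♯
  F̄*-lifts {X} {Y} f = ≈-sym (≈-trans (fold-♯ (init X) (initᴷ X) _) (fold-cong KlCategory (initᴷ X) ♯-step))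
    where
      ♯-step : (i Y ∘ (id +₁ f)) ♯ ≈ i Y ♯ · (kid +ᴷ f ♯)
      ♯-step = ≈-trans ♯-∘ (refl⟩∘⟨ ≈-trans (♯-+₁ cop) (+₁-cong identityʳ ≈-refl))

  e♯-unit : ∀ X → (e′ X) ♯ ≈ unit X
  e♯-unit X = ♯-∘

  ♯-join-algebra : ∀ {X} → [ i X ∘ inl , id ] ♯ ≈ [ i X ♯ · inl ♯ , kid ]
  ♯-join-algebra = ≈-trans (♯-[] cop) ([]-cong ♯-∘ identityʳ)

  m♯-join : ∀ X → (m X) ♯ ≈ join X
  m♯-join X = ≈-trans (fold-♯ (init (F* X)) (initᴷ (F* X)) _) (fold-cong KlCategory (initᴷ (F* X)) ♯-join-algebra)

  m♯-isMonad : IsMonadOn Kl F* F̄*₁ (λ X → (e′ X) ♯) (λ X → (m X) ♯)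
  m♯-isMonad = IsMonadOn-resp KlCategory e♯-unit m♯-join isMonad

  m♯-algebra-map : ∀ X → (m X) ♯ · (i (F* X) ♯) ≈ [ (i X ♯) · (inl ♯) , kid ] · (F̄₁ ((m X) ♯) +ᴷ kid)
  m♯-algebra-map X = ≈-trans (♯-algebra-map (IsInitialAlgebra.fold-eq (init (F* X)) _))
                             (♯-join-algebra ⟩∘⟨refl)

theorem4p10 : ∀ {o ℓ e} (C : Category o ℓ e) (cop : BinaryCoproducts C)
    (T : Monad C) (F : Endofunctor C) (L : Lifting C T F)
    (F* : Category.Obj C → Category.Obj C)
    (i : ∀ X → Category._⇒_ C (BinaryCoproducts._+_ cop (Endofunctor.F₀ F (F* X)) X) (F* X))
    (init : FreeMonadSetting.InitialInC C cop T F L F* i)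
    (initᴷ : FreeMonadSetting.InitialInKl C cop T F L F* i) →
    let open Category C
        open BinaryCoproducts cop
        open Lifting L
        open Kleisli C T
        open KlCoproducts cop
        open FreeMonadSetting.Free C cop T F L F* i init initᴷ
    in
    (∀ {X Y} (f : X ⇒ Y) → F̄*₁ (f ♯) ≈ (F*₁ f) ♯)
    × IsMonadOn Kl F* F̄*₁ (λ X → (e′ X) ♯) (λ X → (m X) ♯)
    × (∀ X → (e′ X) ♯ ≈ (i X ♯) · (inr ♯))
    × (∀ X → (m X) ♯ · (i (F* X) ♯) ≈ [ (i X ♯) · (inl ♯) , kid ] · (F̄₁ ((m X) ♯) +ᴷ kid))
theorem4p10 C cop T F L F* i init initᴷ =
    F̄*-lifts
  , m♯-isMonad
  , e♯-unit
  , m♯-algebra-map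
  where open FreeMonadInKleisli C cop T F L F* i init initᴷ
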